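{- Let $\sigma$ be an unsorted sock pattern that is not of the form $a^i b a^j$ with $i,j\ge 1$. Then for any multiset of socks $M$ such that not all sock sequences on $M$ are sorted, there exists a sock sequence $p^*$ on $M$ that is not $k$-stack-sortable under $\phi_\sigma$ for any $k$, i.e. $\phi_\sigma^k(p^*)$ is unsorted for every $k\ge 0$.
   Context: A sock sequence is a finite sequence of elements ("socks") of a fixed infinite alphabet $A$; a sock sequence on a multiset $M$ of socks is one using exactly the socks of $M$ with their multiplicities. A sock sequence is sorted if, for each sock, all its occurrences appear consecutively. Two sock sequences are equivalent if one is obtained from the other by a bijective renaming of socks; a sock pattern is an equivalence class, represented by its standardized representative (socks renamed so first occurrences read $a,b,c,\dots$). A pattern is unsorted if its representatives are unsorted. A sock sequence contains a pattern $\sigma$ if some (not necessarily consecutive) subsequence of it lies in the class $\sigma$. For a sock pattern $\sigma$, the map $\phi_\sigma$: read the input left to right, using a stack; let $s$ be the sequence of socks on the stack read from top to bottom. At each step, if input socks remain and pushing the leftmost remaining input sock onto the top of the stack would not make $s$ contain $\sigma$, push it; otherwise pop the top sock and append it to the output. Continue until all socks are output; $\phi_\sigma(p)$ is the output. A sequence is $k$-stack-sortable under $\phi_\sigma$ if at most $k$ applications of $\phi_\sigma$ produce a sorted sequence. -}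

module Defs where

open import Data.Nat using (ℕ; zero; suc; _+_; _*_; _<_; _≤_; _≡ᵇ_)
open import Data.Bool using (Bool; true; false; _∧_; if_then_else_; not)
open import Data.List using (List; []; _∷_; length; lookup; reverse; _++_; replicate; map)
open import Data.Bool.ListAction using (any)
open import Data.Fin as Fin using (Fin)
open import Data.Product using (Σ; _×_; ∃)
open import Data.Sum using (_⊎_)
open import Data.Unit using (⊤)
open import Relation.Binary.PropositionalEquality using (_≡_; _≢_)

Sock : Set
Sock = ℕ

-- A sock sequence is sorted if all occurrences of each sock are consecutive:
-- whenever positions i < j < k carry the same sock at i and k, position j
-- carries that sock too.
Sorted : List Sock → Set
Sorted p = ∀ (i j k : Fin (length p)) → i Fin.< j → j Fin.< k →
           lookup p i ≡ lookup p k → lookup p j ≡ lookup p i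

-- Standardized representative of a pattern: first occurrences read 0,1,2,...
-- (StdFrom n xs : the socks seen so far are exactly 0..n-1.)
StdFrom : ℕ → List Sock → Set
StdFrom n [] = ⊤
StdFrom n (x ∷ xs) = (x < n × StdFrom n xs) ⊎ (x ≡ n × StdFrom (suc n) xs)

Standardized : List Sock → Set
Standardized = StdFrom 0

IsAiBAj : List Sock → Set
IsAiBAj σ = Σ Sock λ a → Σ Sock λ b → Σ ℕ λ i → Σ ℕ λ j →
  a ≢ b × 1 ≤ i × 1 ≤ j × σ ≡ replicate i a ++ (b ∷ replicate j a)

-- Two sequences are equivalent (related by a bijective renaming of socks,
-- the alphabet being infinite) iff they have the same length and the same
-- equality pattern between positions.
eqB : Bool → Bool → Bool
eqB a b = if a then b else not b

agree : Sock → Sock → List Sock → List Sock → Bool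
agree x y [] [] = true
agree x y (u ∷ us) (v ∷ vs) = eqB (u ≡ᵇ x) (v ≡ᵇ y) ∧ agree x y us vs
agree x y _ _ = false

equiv? : List Sock → List Sock → Bool
equiv? [] [] = true
equiv? (x ∷ xs) (y ∷ ys) = agree x y xs ys ∧ equiv? xs ys
equiv? _ _ = false

subseqs : ℕ → List Sock → List (List Sock)
subseqs zero xs = [] ∷ []
subseqs (suc n) [] = []
subseqs (suc n) (x ∷ xs) = map (x ∷_) (subseqs n xs) ++ subseqs (suc n) xs

contains? : List Sock → List Sock → Bool
contains? s σ = any (λ q → equiv? q σ) (subseqs (length σ) s)

-- State: remaining input, stack (head = top),
-- output so far (reversed).  Each step pushes or pops one sock, so
-- 2·|p| steps suffice to empty input and stack.
-- (The final clause — input nonempty, push forbidden, stack empty — never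
-- occurs when |σ| ≥ 2, in particular for unsorted σ.)
run : List Sock → ℕ → List Sock → List Sock → List Sock → List Sock
run σ zero inp st out = reverse out ++ (st ++ inp)
run σ (suc f) [] [] out = reverse out
run σ (suc f) [] (y ∷ st) out = run σ f [] st (y ∷ out)
run σ (suc f) (x ∷ inp) st out with contains? (x ∷ st) σ | st
... | false | _ = run σ f inp (x ∷ st) out
... | true | y ∷ st' = run σ f (x ∷ inp) st' (y ∷ out)
... | true | [] = reverse out ++ (x ∷ inp)

φ : List Sock → List Sock → List Sock
φ σ p = run σ (2 * length p) p [] []

iter : ℕ → (List Sock → List Sock) → List Sock → List Sock
iter zero f p = p
iter (suc k) f p = iter k f (f p)

-- If neither p nor its reverse contains σ, then φ_σ pushes all of p and pops it again, so
-- φ_σ p = reverse p and the iterates alternate between p and reverse p; if p contains a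
-- subsequence x y x with x ≠ y they all stay unsorted. Since some arrangement of M is unsorted,
-- M contains socks a ≠ c with a at least twice. Try p = a W a…a, where W lists the other socks
-- grouped. The subsequences of p and of its reverse that contain x y x either contain x y z x
-- with y, z ≠ x or have the excluded shape a^i b a^j, and both properties are invariant under
-- renaming. So if σ (unsorted) occurs in p or its reverse, σ contains some x y z x; then
-- p = c…c a c a…a R, with R grouped, works instead, since it contains no x y z x at all.

module Submission where

open import Defs
open import Data.Bool using (true; false; T)
open import Data.Bool.Properties using (T-≡; T-∧)
open import Data.Empty using (⊥-elim)
open import Data.Fin as Fin using (Fin; zero; suc)
open import Data.List using (List; []; _∷_; [_]; _++_; _ʳ++_; length; reverse; replicate; lookup; map)
open import Data.List.Properties using (++-assoc; ++-identityʳ; reverse-++; reverse-involutive; unfold-reverse)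
open import Data.List.Membership.Propositional using (lose)
open import Data.List.Membership.Propositional.Properties using (∈-lookup)
open import Data.List.Relation.Binary.Permutation.Propositional using (_↭_; ↭-refl; ↭-sym; ↭-trans; prep; module PermutationReasoning)
open import Data.List.Relation.Binary.Permutation.Propositional.Properties using (shift; shifts; ++-comm; ++⁺ˡ; ++⁺ʳ; All-resp-↭; ∈-resp-↭)
open import Data.List.Relation.Binary.Pointwise using (Pointwise; []; _∷_; symmetric)
open import Data.List.Relation.Binary.Sublist.Propositional using (_⊆_; []; _∷_; _∷ʳ_; ⊆-refl; ⊆-trans; minimum; from∈)
open import Data.List.Relation.Binary.Sublist.Propositional.Properties as Sublist using (All-resp-⊆; Any-resp-⊆)
open import Data.List.Relation.Unary.All as All using (All; []; _∷_)
import Data.List.Relation.Unary.All.Properties as Allₚ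
open import Data.List.Relation.Unary.AllPairs using (AllPairs; []; _∷_)
open import Data.List.Relation.Unary.Any using (Any; here; there; any?; satisfied)
open import Data.List.Relation.Unary.Any.Properties as Any using (any⁺; any⁻)
open import Data.List.Relation.Unary.Linked using (Linked)
open import Data.List.Relation.Unary.Linked.Properties using (Linked⇒AllPairs)
open import Data.Nat using (ℕ; zero; suc; _+_; _≤_; _≟_; _≡ᵇ_; z≤n; s≤s)
open import Data.List.Relation.Binary.Sublist.DecPropositional _≟_ using (_⊆?_)
open import Data.Nat.Properties using (≤-antisym; ≤-trans; ≤-decTotalOrder; ≡ᵇ⇒≡; ≡⇒≡ᵇ)
open import Data.List.Sort ≤-decTotalOrder using (sort; sort-↭; sort-↗)
open import Data.Product using (Σ; _×_; _,_; ∃-syntax)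
open import Data.Sum as Sum using (_⊎_; inj₁; inj₂; [_,_]′)
open import Function using (_∘_; id; _⇔_; mk⇔; Equivalence)
import Function.Properties.Equivalence as ⇔
open import Relation.Nullary using (¬_; yes; no; contradiction)
open import Relation.Nullary.Decidable using (Dec; map′; _×-dec_; ¬?; decidable-stable)
open import Relation.Unary using (Decidable)
open import Relation.Binary.PropositionalEquality using (_≡_; _≢_; refl; sym; trans; cong; cong₂; subst; module ≡-Reasoning)

private
  variable
    A : Set
    x y : A
    xs ys zs us vs ws t : List A
    σ p q s : List Sock

module _ {P Q : A → Set} (disjoint : ∀ {z} → P z → ¬ Q z) where

  last-⊆-++ˡ : P x → All Q vs → ∀ zs → zs ++ [ x ] ⊆ us ++ vs → zs ++ [ x ] ⊆ us
  last-⊆-++ˡ {us = []} Px Qvs zs p =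
    contradiction (All.lookup Qvs (Any-resp-⊆ p (Any.++⁺ʳ zs (here refl)))) (disjoint Px)
  last-⊆-++ˡ {us = u ∷ _}  Px Qvs []       (_ ∷ʳ p)   = u ∷ʳ last-⊆-++ˡ Px Qvs [] p
  last-⊆-++ˡ {us = _ ∷ us} Px Qvs []       (refl ∷ _) = refl ∷ minimum us
  last-⊆-++ˡ {us = u ∷ _}  Px Qvs (z ∷ zs) (_ ∷ʳ p)   = u ∷ʳ last-⊆-++ˡ Px Qvs (z ∷ zs) p
  last-⊆-++ˡ {us = _ ∷ _}  Px Qvs (_ ∷ zs) (refl ∷ p) = refl ∷ last-⊆-++ˡ Px Qvs zs p

  enclosed-⊆-++ : All P us → All Q vs → ∀ zs → x ∷ zs ++ [ x ] ⊆ us ++ vs →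
                  x ∷ zs ++ [ x ] ⊆ us ⊎ x ∷ zs ++ [ x ] ⊆ vs
  enclosed-⊆-++              []        Qvs zs p          = inj₂ p
  enclosed-⊆-++ {us = u ∷ _} (_ ∷ Pus) Qvs zs (_ ∷ʳ p)   = Sum.map₁ (u ∷ʳ_) (enclosed-⊆-++ Pus Qvs zs p)
  enclosed-⊆-++              (Pu ∷ _)  Qvs zs (refl ∷ p) = inj₁ (refl ∷ last-⊆-++ˡ Pu Qvs zs p)

⊆-++-split : ∀ us → xs ⊆ us ++ vs → ∃[ xs₁ ] ∃[ xs₂ ] xs ≡ xs₁ ++ xs₂ × xs₁ ⊆ us × xs₂ ⊆ vs
⊆-++-split []       p = [] , _ , refl , [] , p
⊆-++-split (u ∷ us) (_ ∷ʳ p) with ⊆-++-split us p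
... | xs₁ , xs₂ , refl , p₁ , p₂ = xs₁ , xs₂ , refl , u ∷ʳ p₁ , p₂
⊆-++-split (u ∷ us) (refl ∷ p) with ⊆-++-split us p
... | xs₁ , xs₂ , refl , p₁ , p₂ = u ∷ xs₁ , xs₂ , refl , refl ∷ p₁ , p₂

⊆-++-dropˡ : {P : A → Set} → All P vs → ¬ P y → y ∷ ys ⊆ vs ++ ws → y ∷ ys ⊆ ws
⊆-++-dropˡ []         ¬Py p          = p
⊆-++-dropˡ (_ ∷ Pvs)  ¬Py (_ ∷ʳ p)   = ⊆-++-dropˡ Pvs ¬Py p
⊆-++-dropˡ (Pv ∷ _)   ¬Py (refl ∷ _) = contradiction Pv ¬Py

⊆-complement : xs ⊆ ys → ∃[ zs ] ys ↭ xs ++ zs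
⊆-complement [] = [] , ↭-refl
⊆-complement (y ∷ʳ p) with ⊆-complement p
... | zs , ys↭ = y ∷ zs , ↭-trans (prep y ys↭) (↭-sym (shift y _ zs))
⊆-complement (refl ∷ p) with ⊆-complement p
... | zs , ys↭ = zs , prep _ ys↭

AllPairs-resp-⊇ : {R : A → A → Set} → xs ⊆ ys → AllPairs R ys → AllPairs R xs
AllPairs-resp-⊇ []         []        = []
AllPairs-resp-⊇ (_ ∷ʳ p)   (_ ∷ Rs)  = AllPairs-resp-⊇ p Rs
AllPairs-resp-⊇ (refl ∷ p) (R ∷ Rs)  = All-resp-⊆ p R ∷ AllPairs-resp-⊇ p Rs

partition-↭ : {P : A → Set} → Decidable P → ∀ xs →
              ∃[ ys ] ∃[ zs ] xs ↭ ys ++ zs × All P ys × All (¬_ ∘ P) zs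
partition-↭ P? [] = [] , [] , ↭-refl , [] , []
partition-↭ P? (x ∷ xs) with P? x | partition-↭ P? xs
... | yes Px  | ys , zs , xs↭ , Pys , ¬Pzs = x ∷ ys , zs , prep x xs↭ , Px ∷ Pys , ¬Pzs
... | no  ¬Px | ys , zs , xs↭ , Pys , ¬Pzs =
  ys , x ∷ zs , ↭-trans (prep x xs↭) (↭-sym (shift x ys zs)) , Pys , ¬Px ∷ ¬Pzs

Pointwise-++⁻ : {R : A → A → Set} → ∀ xs → Pointwise R (xs ++ ys) zs →
                ∃[ zs₁ ] ∃[ zs₂ ] zs ≡ zs₁ ++ zs₂ × Pointwise R xs zs₁ × Pointwise R ys zs₂
Pointwise-++⁻ []       Rs       = [] , _ , refl , [] , Rs
Pointwise-++⁻ (_ ∷ xs) (R ∷ Rs) with Pointwise-++⁻ xs Rs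
... | zs₁ , zs₂ , refl , Rs₁ , Rs₂ = _ ∷ zs₁ , zs₂ , refl , R ∷ Rs₁ , Rs₂

All-≡-replicate : All (_≡ x) xs → xs ≡ replicate (length xs) x
All-≡-replicate []          = refl
All-≡-replicate (refl ∷ xs) = cong (_ ∷_) (All-≡-replicate xs)

reverse-replicate : ∀ n → reverse (replicate n x) ≡ replicate n x
reverse-replicate         zero    = refl
reverse-replicate {x = x} (suc n) = begin
  reverse (x ∷ replicate n x)      ≡⟨ unfold-reverse x (replicate n x) ⟩
  reverse (replicate n x) ++ [ x ] ≡⟨ cong (_++ [ x ]) (reverse-replicate n) ⟩
  replicate n x ++ [ x ]           ≡⟨ replicate-++-[] n ⟩
  x ∷ replicate n x                ∎
  where
  open ≡-Reasoning
  replicate-++-[] : ∀ n → replicate n x ++ [ x ] ≡ x ∷ replicate n x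
  replicate-++-[] zero    = refl
  replicate-++-[] (suc n) = cong (x ∷_) (replicate-++-[] n)

-- Sortedness and the patterns xyx and xyzx

⊆-index : xs ⊆ ys → Fin (length xs) → Fin (length ys)
⊆-index (_ ∷ʳ p) i       = suc (⊆-index p i)
⊆-index (_ ∷ p)  zero    = zero
⊆-index (_ ∷ p)  (suc i) = suc (⊆-index p i)

lookup-⊆-index : (p : xs ⊆ ys) (i : Fin (length xs)) → lookup ys (⊆-index p i) ≡ lookup xs i
lookup-⊆-index (_ ∷ʳ p)   i       = lookup-⊆-index p i
lookup-⊆-index (refl ∷ p) zero    = refl
lookup-⊆-index (refl ∷ p) (suc i) = lookup-⊆-index p i

⊆-index-mono : (p : xs ⊆ ys) {i j : Fin (length xs)} → i Fin.< j → ⊆-index p i Fin.< ⊆-index p j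
⊆-index-mono (_ ∷ʳ p) i<j                       = s≤s (⊆-index-mono p i<j)
⊆-index-mono (_ ∷ p)  {zero}  {suc j} _         = s≤s z≤n
⊆-index-mono (_ ∷ p)  {suc i} {suc j} (s≤s i<j) = s≤s (⊆-index-mono p i<j)

Sorted-resp-⊇ : xs ⊆ ys → Sorted ys → Sorted xs
Sorted-resp-⊇ {xs = xs} {ys = ys} p sorted i j k i<j j<k xsᵢ≡xsₖ = begin
  lookup xs j     ≡⟨ lookup-⊆-index p j ⟨
  lookup ys (ι j) ≡⟨ sorted (ι i) (ι j) (ι k) (⊆-index-mono p i<j) (⊆-index-mono p j<k) ysᵢ≡ysₖ ⟩
  lookup ys (ι i) ≡⟨ lookup-⊆-index p i ⟩
  lookup xs i     ∎
  where
  open ≡-Reasoning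
  ι = ⊆-index p
  ysᵢ≡ysₖ = trans (lookup-⊆-index p i) (trans xsᵢ≡xsₖ (sym (lookup-⊆-index p k)))

lookup₂-⊆ : ∀ (s : List A) (i j : Fin (length s)) → i Fin.< j → lookup s i ∷ lookup s j ∷ [] ⊆ s
lookup₂-⊆ (x ∷ s) zero    (suc j) _         = refl ∷ from∈ (∈-lookup j)
lookup₂-⊆ (x ∷ s) (suc i) (suc j) (s≤s i<j) = x ∷ʳ lookup₂-⊆ s i j i<j

lookup₃-⊆ : ∀ (s : List A) (i j k : Fin (length s)) → i Fin.< j → j Fin.< k →
            lookup s i ∷ lookup s j ∷ lookup s k ∷ [] ⊆ s
lookup₃-⊆ (x ∷ s) zero    (suc j) (suc k) _         (s≤s j<k) = refl ∷ lookup₂-⊆ s j k j<k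
lookup₃-⊆ (x ∷ s) (suc i) (suc j) (suc k) (s≤s i<j) (s≤s j<k) = x ∷ʳ lookup₃-⊆ s i j k i<j j<k

HasXYX : List Sock → Set
HasXYX s = ∃[ x ] ∃[ y ] x ≢ y × x ∷ y ∷ x ∷ [] ⊆ s

HasXYX-⊆ : s ⊆ p → HasXYX s → HasXYX p
HasXYX-⊆ s⊆p (x , y , x≢y , xyx⊆s) = x , y , x≢y , ⊆-trans xyx⊆s s⊆p

HasXYX-reverse : HasXYX s → HasXYX (reverse s)
HasXYX-reverse (x , y , x≢y , xyx⊆s) = x , y , x≢y , Sublist.reverse⁺ xyx⊆s

HasXYX⇒¬Sorted : HasXYX s → ¬ Sorted s
HasXYX⇒¬Sorted (x , y , x≢y , xyx⊆s) sorted =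
  x≢y (sym (Sorted-resp-⊇ xyx⊆s sorted zero (suc zero) (suc (suc zero)) (s≤s z≤n) (s≤s (s≤s z≤n)) refl))

¬HasXYX⇒Sorted : ¬ HasXYX s → Sorted s
¬HasXYX⇒Sorted {s} no-xyx i j k i<j j<k sᵢ≡sₖ with lookup s j ≟ lookup s i
... | yes sⱼ≡sᵢ = sⱼ≡sᵢ
... | no  sⱼ≢sᵢ = contradiction (lookup s i , lookup s j , sⱼ≢sᵢ ∘ sym , xyx⊆s) no-xyx
  where
  xyx⊆s = subst (λ z → lookup s i ∷ lookup s j ∷ z ∷ [] ⊆ s) (sym sᵢ≡sₖ) (lookup₃-⊆ s i j k i<j j<k)

HasXYX? : ∀ s → Dec (HasXYX s)
HasXYX? s = map′ witness occurrence (any? (λ x → any? (λ y → ¬? (x ≟ y) ×-dec (x ∷ y ∷ x ∷ [] ⊆? s)) s) s)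
  where
  witness : Any (λ x → Any (λ y → x ≢ y × x ∷ y ∷ x ∷ [] ⊆ s) s) s → HasXYX s
  witness found with satisfied found
  ... | x , found′ with satisfied found′
  ... | y , x≢y , xyx⊆s = x , y , x≢y , xyx⊆s
  occurrence : HasXYX s → Any (λ x → Any (λ y → x ≢ y × x ∷ y ∷ x ∷ [] ⊆ s) s) s
  occurrence (x , y , x≢y , xyx⊆s) =
    lose (Any-resp-⊆ xyx⊆s (here refl)) (lose (Any-resp-⊆ xyx⊆s (there (here refl))) (x≢y , xyx⊆s))

¬Sorted⇒HasXYX : ¬ Sorted s → HasXYX s
¬Sorted⇒HasXYX {s} unsorted = decidable-stable (HasXYX? s) (unsorted ∘ ¬HasXYX⇒Sorted)

Linked-≤⇒¬HasXYX : Linked _≤_ s → ¬ HasXYX s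
Linked-≤⇒¬HasXYX s↗ (x , y , x≢y , xyx⊆s)
  with AllPairs-resp-⊇ xyx⊆s (Linked⇒AllPairs ≤-trans s↗)
... | (x≤y ∷ _) ∷ (y≤x ∷ []) ∷ [] ∷ [] = x≢y (≤-antisym x≤y y≤x)

All-≡⇒¬HasXYX : {a : Sock} → All (_≡ a) s → ¬ HasXYX s
All-≡⇒¬HasXYX s≡a (x , y , x≢y , xyx⊆s) with All-resp-⊆ xyx⊆s s≡a
... | x≡a ∷ y≡a ∷ _ = x≢y (trans x≡a (sym y≡a))

¬HasXYX-++ : {P Q : Sock → Set} → (∀ {z} → P z → ¬ Q z) → All P s → All Q p →
             ¬ HasXYX s → ¬ HasXYX p → ¬ HasXYX (s ++ p)
¬HasXYX-++ disjoint Ps Qp s-free p-free (x , y , x≢y , xyx⊆sp) =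
  [ (λ xyx⊆s → s-free (x , y , x≢y , xyx⊆s)) , (λ xyx⊆p → p-free (x , y , x≢y , xyx⊆p)) ]′
    (enclosed-⊆-++ disjoint Ps Qp (y ∷ []) xyx⊆sp)

HasXYZX : List Sock → Set
HasXYZX s = ∃[ x ] ∃[ y ] ∃[ z ] y ≢ x × z ≢ x × x ∷ y ∷ z ∷ x ∷ [] ⊆ s

HasXYZX-⊆ : s ⊆ p → HasXYZX s → HasXYZX p
HasXYZX-⊆ s⊆p (x , y , z , y≢x , z≢x , xyzx⊆s) = x , y , z , y≢x , z≢x , ⊆-trans xyzx⊆s s⊆p

HasXYZX-reverse : HasXYZX s → HasXYZX (reverse s)
HasXYZX-reverse (x , y , z , y≢x , z≢x , xyzx⊆s) = x , z , y , z≢x , y≢x , Sublist.reverse⁺ xyzx⊆s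

HasXYZX⇒HasXYX : HasXYZX s → HasXYX s
HasXYZX⇒HasXYX (x , y , z , y≢x , _ , xyzx⊆s) =
  x , y , y≢x ∘ sym , ⊆-trans (refl ∷ refl ∷ z ∷ʳ refl ∷ []) xyzx⊆s

¬HasXYZX-++ : {P Q : Sock → Set} → (∀ {z} → P z → ¬ Q z) → All P s → All Q p →
              ¬ HasXYZX s → ¬ HasXYZX p → ¬ HasXYZX (s ++ p)
¬HasXYZX-++ disjoint Ps Qp s-free p-free (x , y , z , y≢x , z≢x , xyzx⊆sp) =
  [ (λ xyzx⊆s → s-free (x , y , z , y≢x , z≢x , xyzx⊆s))
  , (λ xyzx⊆p → p-free (x , y , z , y≢x , z≢x , xyzx⊆p)) ]′
    (enclosed-⊆-++ disjoint Ps Qp (y ∷ z ∷ []) xyzx⊆sp)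

-- Pattern equivalence and containment

Agree : Sock → Sock → List Sock → List Sock → Set
Agree x y = Pointwise (λ u v → (u ≡ x) ⇔ (v ≡ y))

infix 4 _∼_
data _∼_ : List Sock → List Sock → Set where
  []  : [] ∼ []
  _∷_ : {x y : Sock} → Agree x y xs ys → xs ∼ ys → x ∷ xs ∼ y ∷ ys

T-eqB : ∀ a b → T (eqB a b) → a ≡ b
T-eqB true  true  _ = refl
T-eqB false false _ = refl

eqB-sound : ∀ u x v y → T (eqB (u ≡ᵇ x) (v ≡ᵇ y)) → (u ≡ x) ⇔ (v ≡ y)
eqB-sound u x v y h = mk⇔
  (λ u≡x → ≡ᵇ⇒≡ v y (subst T same (≡⇒≡ᵇ u x u≡x)))
  (λ v≡y → ≡ᵇ⇒≡ u x (subst T (sym same) (≡⇒≡ᵇ v y v≡y)))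
  where same = T-eqB (u ≡ᵇ x) (v ≡ᵇ y) h

agree-sound : ∀ x y us vs → T (agree x y us vs) → Agree x y us vs
agree-sound x y []       []       _ = []
agree-sound x y (u ∷ us) (v ∷ vs) h with Equivalence.to T-∧ h
... | h₁ , h₂ = eqB-sound u x v y h₁ ∷ agree-sound x y us vs h₂

equiv?-sound : ∀ xs ys → T (equiv? xs ys) → xs ∼ ys
equiv?-sound []       []       _ = []
equiv?-sound (x ∷ xs) (y ∷ ys) h with Equivalence.to T-∧ h
... | h₁ , h₂ = agree-sound x y xs ys h₁ ∷ equiv?-sound xs ys h₂

∼-sym : q ∼ σ → σ ∼ q
∼-sym []         = []
∼-sym (ag ∷ q∼σ) = symmetric ⇔.sym ag ∷ ∼-sym q∼σ

-- The entries of us at the positions that p picks out of ys (junk unless us, ys have equal length).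
select : xs ⊆ ys → List A → List A
select []       _        = []
select (_ ∷ʳ p) []       = []
select (_ ∷ʳ p) (u ∷ us) = select p us
select (_ ∷ p)  []       = []
select (_ ∷ p)  (u ∷ us) = u ∷ select p us

select-⊆ : (p : xs ⊆ ys) (us : List A) → select p us ⊆ us
select-⊆ []       us       = minimum us
select-⊆ (_ ∷ʳ p) []       = []
select-⊆ (_ ∷ʳ p) (u ∷ us) = u ∷ʳ select-⊆ p us
select-⊆ (_ ∷ p)  []       = []
select-⊆ (_ ∷ p)  (u ∷ us) = refl ∷ select-⊆ p us

Pointwise-select : {R : A → A → Set} → Pointwise R us vs → (p : t ⊆ vs) → Pointwise R (select p us) t
Pointwise-select []       []         = []
Pointwise-select (_ ∷ Rs) (_ ∷ʳ p)   = Pointwise-select Rs p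
Pointwise-select (R ∷ Rs) (refl ∷ p) = R ∷ Pointwise-select Rs p

∼-select : q ∼ σ → (p : t ⊆ σ) → select p q ∼ t
∼-select []         []         = []
∼-select (_ ∷ q∼σ)  (_ ∷ʳ p)   = ∼-select q∼σ p
∼-select (ag ∷ q∼σ) (refl ∷ p) = Pointwise-select ag p ∷ ∼-select q∼σ p

∼-⊆ : q ∼ σ → t ⊆ σ → ∃[ t′ ] t′ ⊆ q × t′ ∼ t
∼-⊆ {q} q∼σ p = select p q , select-⊆ p q , ∼-select q∼σ p

HasXYX-resp-∼ : q ∼ σ → HasXYX q → HasXYX σ
HasXYX-resp-∼ q∼σ (x , y , x≢y , xyx⊆q) with ∼-⊆ (∼-sym q∼σ) xyx⊆q
... | u ∷ v ∷ w ∷ [] , uvw⊆σ , (v⇔y ∷ w⇔x ∷ []) ∷ _ =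
  u , v , x≢y ∘ sym ∘ Equivalence.to v⇔y ∘ sym ,
  subst (λ w → u ∷ v ∷ w ∷ [] ⊆ _) (Equivalence.from w⇔x refl) uvw⊆σ

HasXYZX-resp-∼ : q ∼ σ → HasXYZX q → HasXYZX σ
HasXYZX-resp-∼ q∼σ (x , y , z , y≢x , z≢x , xyzx⊆q) with ∼-⊆ (∼-sym q∼σ) xyzx⊆q
... | u ∷ v ∷ w ∷ r ∷ [] , uvwr⊆σ , (v⇔y ∷ w⇔z ∷ r⇔x ∷ []) ∷ _ =
  u , v , w , y≢x ∘ Equivalence.to v⇔y , z≢x ∘ Equivalence.to w⇔z ,
  subst (λ r → u ∷ v ∷ w ∷ r ∷ [] ⊆ _) (Equivalence.from r⇔x refl) uvwr⊆σ

Agree-replicate : ∀ {a s} n → Agree a s (replicate n a) vs → vs ≡ replicate n s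
Agree-replicate zero    []        = refl
Agree-replicate (suc n) (v⇔ ∷ ag) = cong₂ _∷_ (Equivalence.to v⇔ refl) (Agree-replicate n ag)

IsAiBAj-resp-∼ : q ∼ σ → IsAiBAj q → IsAiBAj σ
IsAiBAj-resp-∼ {σ = s ∷ _} (ag ∷ _) (a , b , suc i , j , a≢b , _ , 1≤j , refl)
  with Pointwise-++⁻ (replicate i a) ag
... | vs₁ , t ∷ vs₂ , refl , ag₁ , b⇔t ∷ ag₂
  rewrite Agree-replicate i ag₁ | Agree-replicate j ag₂ =
  s , t , suc i , j , a≢b ∘ sym ∘ Equivalence.from b⇔t ∘ sym , s≤s z≤n , 1≤j , refl

IsAiBAj-reverse : IsAiBAj s → IsAiBAj (reverse s)
IsAiBAj-reverse (a , b , i , j , a≢b , 1≤i , 1≤j , refl) = a , b , j , i , a≢b , 1≤j , 1≤i , (begin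
  reverse (replicate i a ++ b ∷ replicate j a)            ≡⟨ reverse-++ (replicate i a) (b ∷ replicate j a) ⟩
  reverse (b ∷ replicate j a) ++ reverse (replicate i a)  ≡⟨ cong₂ _++_ (unfold-reverse b (replicate j a)) (reverse-replicate i) ⟩
  (reverse (replicate j a) ++ [ b ]) ++ replicate i a     ≡⟨ ++-assoc (reverse (replicate j a)) [ b ] (replicate i a) ⟩
  reverse (replicate j a) ++ b ∷ replicate i a            ≡⟨ cong (_++ b ∷ replicate i a) (reverse-replicate j) ⟩
  replicate j a ++ b ∷ replicate i a                      ∎)
  where open ≡-Reasoning

subseqs-sound : {P : List Sock → Set} → ∀ n s → Any P (subseqs n s) → ∃[ q ] q ⊆ s × P q
subseqs-sound zero    s       (here Pq) = [] , minimum s , Pq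
subseqs-sound (suc n) (x ∷ s) found with Any.++⁻ (map (x ∷_) (subseqs n s)) found
... | inj₁ found′ with subseqs-sound n s (Any.map⁻ found′)
...   | q , q⊆s , Pq = x ∷ q , refl ∷ q⊆s , Pq
subseqs-sound (suc n) (x ∷ s) found | inj₂ found′ with subseqs-sound (suc n) s found′
...   | q , q⊆s , Pq = q , x ∷ʳ q⊆s , Pq

subseqs-mono : {P : List Sock → Set} → ∀ n → s ⊆ p → Any P (subseqs n s) → Any P (subseqs n p)
subseqs-mono zero    _          found = found
subseqs-mono (suc n) (y ∷ʳ s⊆p) found = Any.++⁺ʳ (map (y ∷_) (subseqs n _)) (subseqs-mono (suc n) s⊆p found)
subseqs-mono (suc n) (refl ∷ s⊆p) found with Any.++⁻ (map (_ ∷_) (subseqs n _)) found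
... | inj₁ found′ = Any.++⁺ˡ (Any.map⁺ (subseqs-mono n s⊆p (Any.map⁻ found′)))
... | inj₂ found′ = Any.++⁺ʳ _ (subseqs-mono (suc n) s⊆p found′)

contains?-mono : s ⊆ p → T (contains? s σ) → T (contains? p σ)
contains?-mono {σ = σ} s⊆p = any⁺ _ ∘ subseqs-mono (length σ) s⊆p ∘ any⁻ _ _

contains?-sound : contains? s σ ≡ true → ∃[ q ] q ⊆ s × q ∼ σ
contains?-sound {s} {σ} c with subseqs-sound (length σ) s (any⁻ _ _ (Equivalence.from T-≡ c))
... | q , q⊆s , q≈σ = q , q⊆s , equiv?-sound q σ q≈σ

Avoids : List Sock → List Sock → Set
Avoids s σ = contains? s σ ≡ false

Avoids-resp-⊇ : s ⊆ p → Avoids p σ → Avoids s σ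
Avoids-resp-⊇ {s} {σ = σ} s⊆p p-avoids with contains? s σ in c
... | false = refl
... | true  = ⊥-elim (subst T p-avoids (contains?-mono {σ = σ} s⊆p (Equivalence.from T-≡ c)))

¬HasXYZX⇒Avoids : HasXYZX σ → ¬ HasXYZX s → Avoids s σ
¬HasXYZX⇒Avoids {σ} {s} σ-xyzx s-free with contains? s σ in c
... | false = refl
... | true with contains?-sound c
...   | q , q⊆s , q∼σ = contradiction (HasXYZX-⊆ q⊆s (HasXYZX-resp-∼ (∼-sym q∼σ) σ-xyzx)) s-free

-- The stack-sorting map on sequences avoiding σ

run-pops : ∀ σ f st out → run σ f [] st out ≡ reverse out ++ st
run-pops σ zero    st       out = cong (reverse out ++_) (++-identityʳ st)
run-pops σ (suc f) []       out = sym (++-identityʳ (reverse out))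
run-pops σ (suc f) (y ∷ st) out = begin
  run σ f [] st (y ∷ out)          ≡⟨ run-pops σ f st (y ∷ out) ⟩
  reverse (y ∷ out) ++ st          ≡⟨ cong (_++ st) (unfold-reverse y out) ⟩
  (reverse out ++ [ y ]) ++ st     ≡⟨ ++-assoc (reverse out) [ y ] st ⟩
  reverse out ++ y ∷ st            ∎
  where open ≡-Reasoning

run-pushes : ∀ σ f inp st out → Avoids (inp ʳ++ st) σ →
             run σ (length inp + f) inp st out ≡ run σ f [] (inp ʳ++ st) out
run-pushes σ f []        st out _ = refl
run-pushes σ f (x ∷ inp) st out avoids
  with contains? (x ∷ st) σ in c
... | false = run-pushes σ f inp (x ∷ st) out avoids
... | true  = contradiction (trans (sym c) x∷st-avoids) λ ()
  where x∷st-avoids = Avoids-resp-⊇ {σ = σ} (Sublist.ʳ++⁺ (minimum inp) ⊆-refl) avoids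

-- The fuel 2 * length p of φ is exactly length p pushes followed by length p pops.
φ-reverse : Avoids (reverse p) σ → φ σ p ≡ reverse p
φ-reverse {p} {σ} avoids = begin
  φ σ p                                  ≡⟨ run-pushes σ (length p + 0) p [] [] avoids ⟩
  run σ (length p + 0) [] (reverse p) [] ≡⟨ run-pops σ (length p + 0) (reverse p) [] ⟩
  reverse p                              ∎
  where open ≡-Reasoning

never-sorted : Avoids p σ → Avoids (reverse p) σ → HasXYX p → ∀ k → ¬ Sorted (iter k (φ σ) p)
never-sorted _ _ p-xyx zero = HasXYX⇒¬Sorted p-xyx
never-sorted {p} {σ} p-avoids rp-avoids p-xyx (suc k) =
  subst (λ r → ¬ Sorted (iter k (φ σ) r)) (sym (φ-reverse {p = p} {σ = σ} rp-avoids))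
    (never-sorted {p = reverse p} {σ = σ} rp-avoids rrp-avoids (HasXYX-reverse p-xyx) k)
  where
  rrp-avoids : Avoids (reverse (reverse p)) σ
  rrp-avoids = subst (λ r → Avoids r σ) (sym (reverse-involutive p)) p-avoids

-- The two rearrangements

XYXDichotomy : List Sock → Set
XYXDichotomy s = ∀ {q} → q ⊆ s → HasXYX q → HasXYZX q ⊎ IsAiBAj q

XYXDichotomy-reverse : XYXDichotomy s → XYXDichotomy (reverse s)
XYXDichotomy-reverse {s} dichotomy {q} q⊆rs q-xyx =
  Sum.map (unreverse HasXYZX HasXYZX-reverse) (unreverse IsAiBAj IsAiBAj-reverse)
    (dichotomy (subst (reverse q ⊆_) (reverse-involutive s) (Sublist.reverse⁺ q⊆rs)) (HasXYX-reverse q-xyx))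
  where
  unreverse : (P : List Sock → Set) → (∀ {t} → P t → P (reverse t)) → P (reverse q) → P q
  unreverse P P-reverse = subst P (reverse-involutive q) ∘ P-reverse

¬HasXYX-∷ : {a : Sock} → All (_≢ a) s → ¬ HasXYX s → ¬ HasXYX (a ∷ s)
¬HasXYX-∷ s≢a s-free = ¬HasXYX-++ (λ z≡a z≢a → z≢a z≡a) (refl ∷ []) s≢a (All-≡⇒¬HasXYX (refl ∷ [])) s-free

-- A subsequence keeping the leading a is a b₁ … bₘ a … a with the bᵢ from W; the others have no xyx.
XYXDichotomy-∷-++ : {a : Sock} {W A : List Sock} → All (_≢ a) W → ¬ HasXYX W → All (_≡ a) A →
                    XYXDichotomy (a ∷ W ++ A)
XYXDichotomy-∷-++ W≢a W-free A≡a (_ ∷ʳ q⊆WA) q-xyx =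
  contradiction (HasXYX-⊆ q⊆WA q-xyx) (¬HasXYX-++ (λ z≢a z≡a → z≢a z≡a) W≢a A≡a W-free (All-≡⇒¬HasXYX A≡a))
XYXDichotomy-∷-++ {a} {W} W≢a W-free A≡a (refl ∷ q⊆WA) q-xyx with ⊆-++-split W q⊆WA
... | q₁ , [] , refl , q₁⊆W , _ =
  contradiction (HasXYX-⊆ (refl ∷ subst (_⊆ W) (sym (++-identityʳ q₁)) q₁⊆W) q-xyx) (¬HasXYX-∷ W≢a W-free)
... | [] , q₂ , refl , _ , q₂⊆A = contradiction q-xyx (All-≡⇒¬HasXYX (refl ∷ All-resp-⊆ q₂⊆A A≡a))
... | b ∷ [] , d ∷ q₂ , refl , q₁⊆W , q₂⊆A with All-resp-⊆ q₁⊆W W≢a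
...   | b≢a ∷ [] =
  inj₂ (a , b , 1 , length (d ∷ q₂) , b≢a ∘ sym , s≤s z≤n , s≤s z≤n ,
        cong (λ r → a ∷ b ∷ r) (All-≡-replicate (All-resp-⊆ q₂⊆A A≡a)))
XYXDichotomy-∷-++ {a} {W} W≢a W-free A≡a (refl ∷ q⊆WA) q-xyx
  | b₁ ∷ b₂ ∷ q₁ , d ∷ q₂ , refl , q₁⊆W , q₂⊆A with All-resp-⊆ q₁⊆W W≢a | All-resp-⊆ q₂⊆A A≡a
...   | b₁≢a ∷ b₂≢a ∷ _ | refl ∷ _ =
  inj₁ (a , b₁ , b₂ , b₁≢a , b₂≢a , refl ∷ refl ∷ refl ∷ Sublist.++⁺ˡ q₁ (refl ∷ minimum q₂))

dichotomy⇒HasXYZX : HasXYX σ → ¬ IsAiBAj σ → XYXDichotomy s → contains? s σ ≡ true → HasXYZX σ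
dichotomy⇒HasXYZX σ-xyx σ-aiba dichotomy c with contains?-sound c
... | q , q⊆s , q∼σ with dichotomy q⊆s (HasXYX-resp-∼ (∼-sym q∼σ) σ-xyx)
...   | inj₁ q-xyzx = HasXYZX-resp-∼ q∼σ q-xyzx
...   | inj₂ q-aiba = contradiction (IsAiBAj-resp-∼ q∼σ q-aiba) σ-aiba

never-sorted-or-HasXYZX : HasXYX σ → ¬ IsAiBAj σ → XYXDichotomy p → HasXYX p →
                          (∀ k → ¬ Sorted (iter k (φ σ) p)) ⊎ HasXYZX σ
never-sorted-or-HasXYZX {σ} {p} σ-xyx σ-aiba dichotomy p-xyx
  with contains? p σ in c | contains? (reverse p) σ in c′
... | false | false = inj₁ (never-sorted c c′ p-xyx)
... | true  | _     = inj₂ (dichotomy⇒HasXYZX σ-xyx σ-aiba dichotomy c)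
... | false | true  = inj₂ (dichotomy⇒HasXYZX σ-xyx σ-aiba (XYXDichotomy-reverse dichotomy) c′)

last-⊈-All-≡ : {a c : Sock} {A : List Sock} → a ≢ c → All (_≡ a) A → ∀ zs → ¬ (zs ++ [ c ] ⊆ A)
last-⊈-All-≡ a≢c A≡a zs p = a≢c (sym (All.lookup A≡a (Any-resp-⊆ p (Any.++⁺ʳ zs (here refl)))))

yzc⊈a∷c∷A : {a c y z : Sock} {A : List Sock} → a ≢ c → All (_≡ a) A → y ≢ c → z ≢ c →
            ¬ (y ∷ z ∷ c ∷ [] ⊆ a ∷ c ∷ A)
yzc⊈a∷c∷A {c = c} {z = z} a≢c A≡a y≢c z≢c (refl ∷ zc⊆cA) =
  last-⊈-All-≡ a≢c A≡a (z ∷ []) (⊆-++-dropˡ {P = _≡ c} (refl ∷ []) z≢c zc⊆cA)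
yzc⊈a∷c∷A {c = c} {y = y} {z = z} a≢c A≡a y≢c z≢c (_ ∷ʳ yzc⊆cA) =
  last-⊈-All-≡ a≢c A≡a (y ∷ z ∷ []) (⊆-++-dropˡ {P = _≡ c} (refl ∷ []) y≢c yzc⊆cA)

¬HasXYZX-C++a∷c∷A : {a c : Sock} {C A : List Sock} → a ≢ c → All (_≡ c) C → All (_≡ a) A →
                    ¬ HasXYZX (C ++ a ∷ c ∷ A)
¬HasXYZX-C++a∷c∷A a≢c [] A≡a (_ , _ , _ , y≢x , _ , refl ∷ _ ∷ʳ yza⊆A) with All-resp-⊆ yza⊆A A≡a
... | y≡a ∷ _ = y≢x y≡a
¬HasXYZX-C++a∷c∷A a≢c [] A≡a (_ , _ , _ , _ , z≢x , refl ∷ refl ∷ za⊆A) with All-resp-⊆ za⊆A A≡a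
... | z≡a ∷ _ = z≢x z≡a
¬HasXYZX-C++a∷c∷A a≢c [] A≡a (_ , _ , _ , _ , _ , _ ∷ʳ refl ∷ yzc⊆A) with All-resp-⊆ yzc⊆A A≡a
... | _ ∷ _ ∷ c≡a ∷ [] = a≢c (sym c≡a)
¬HasXYZX-C++a∷c∷A a≢c [] A≡a (_ , _ , _ , y≢x , _ , _ ∷ʳ _ ∷ʳ xyzx⊆A) with All-resp-⊆ xyzx⊆A A≡a
... | x≡a ∷ y≡a ∷ _ = y≢x (trans y≡a (sym x≡a))
¬HasXYZX-C++a∷c∷A a≢c (_ ∷ C≡c) A≡a (x , y , z , y≢x , z≢x , _ ∷ʳ xyzx⊆) =
  ¬HasXYZX-C++a∷c∷A a≢c C≡c A≡a (x , y , z , y≢x , z≢x , xyzx⊆)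
¬HasXYZX-C++a∷c∷A a≢c (refl ∷ C≡c) A≡a (_ , _ , _ , y≢c , z≢c , refl ∷ yzc⊆) =
  yzc⊈a∷c∷A a≢c A≡a y≢c z≢c (⊆-++-dropˡ C≡c y≢c yzc⊆)

NeverSortableOn : List Sock → List Sock → Set
NeverSortableOn σ M = ∃[ p ] p ↭ M × ((k : ℕ) → ¬ Sorted (iter k (φ σ) p))

NeverSortableOn-resp-↭ : {M M′ : List Sock} → M ↭ M′ → NeverSortableOn σ M → NeverSortableOn σ M′
NeverSortableOn-resp-↭ M↭M′ (p , p↭M , never) = p , ↭-trans p↭M M↭M′ , never

rearrangement-or-HasXYZX : {a c : Sock} → HasXYX σ → ¬ IsAiBAj σ → a ≢ c → ∀ N →
                           NeverSortableOn σ (a ∷ c ∷ a ∷ N) ⊎ HasXYZX σ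
rearrangement-or-HasXYZX {σ} {a} {c} σ-xyx σ-aiba a≢c N with partition-↭ (_≟ a) N
... | A , B , N↭AB , A≡a , B≢a =
  Sum.map₁ (λ never → a ∷ W ++ a ∷ A , perm , never)
    (never-sorted-or-HasXYZX σ-xyx σ-aiba
      (XYXDichotomy-∷-++ W≢a (Linked-≤⇒¬HasXYX (sort-↗ (c ∷ B))) (refl ∷ A≡a)) aca)
  where
  W = sort (c ∷ B)
  W≢a : All (_≢ a) W
  W≢a = All-resp-↭ (↭-sym (sort-↭ (c ∷ B))) ((a≢c ∘ sym) ∷ B≢a)
  aca : HasXYX (a ∷ W ++ a ∷ A)
  aca = a , c , a≢c , refl ∷ Sublist.++⁺ (from∈ c∈W) (refl ∷ minimum A)
    where c∈W = ∈-resp-↭ (↭-sym (sort-↭ (c ∷ B))) (here refl)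
  perm : a ∷ W ++ a ∷ A ↭ a ∷ c ∷ a ∷ N
  perm = begin
    a ∷ W ++ a ∷ A         ↭⟨ prep a (++⁺ʳ (a ∷ A) (sort-↭ (c ∷ B))) ⟩
    a ∷ c ∷ B ++ a ∷ A     ↭⟨ prep a (prep c (shift a B A)) ⟩
    a ∷ c ∷ a ∷ B ++ A     ↭⟨ prep a (prep c (prep a (++-comm B A))) ⟩
    a ∷ c ∷ a ∷ A ++ B     ↭⟨ prep a (prep c (prep a (↭-sym N↭AB))) ⟩
    a ∷ c ∷ a ∷ N          ∎
    where open PermutationReasoning

HasXYZX⇒rearrangement : {a c : Sock} → HasXYZX σ → a ≢ c → ∀ N → NeverSortableOn σ (a ∷ c ∷ a ∷ N)
HasXYZX⇒rearrangement {σ} {a} {c} σ-xyzx a≢c N with partition-↭ (_≟ a) N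
... | A , B , N↭AB , A≡a , B≢a with partition-↭ (_≟ c) B
... | C , R , B↭CR , C≡c , R≢c =
  L ++ sort R , perm ,
  never-sorted (¬HasXYZX⇒Avoids σ-xyzx xyzx-free) (¬HasXYZX⇒Avoids σ-xyzx (xyzx-free ∘ unreverse)) aca
  where
  L = C ++ a ∷ c ∷ a ∷ A
  L-inside : All (λ z → z ≡ a ⊎ z ≡ c) L
  L-inside = Allₚ.++⁺ (All.map inj₂ C≡c) (inj₁ refl ∷ inj₂ refl ∷ All.map inj₁ (refl ∷ A≡a))
  sortR-outside : All (λ z → z ≢ a × z ≢ c) (sort R)
  sortR-outside = All-resp-↭ (↭-sym (sort-↭ R)) (All.zip (Allₚ.++⁻ʳ C (All-resp-↭ B↭CR B≢a) , R≢c))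
  xyzx-free : ¬ HasXYZX (L ++ sort R)
  xyzx-free = ¬HasXYZX-++ (λ { (inj₁ z≡a) (z≢a , _) → z≢a z≡a ; (inj₂ z≡c) (_ , z≢c) → z≢c z≡c })
    L-inside sortR-outside (¬HasXYZX-C++a∷c∷A a≢c C≡c (refl ∷ A≡a))
    (Linked-≤⇒¬HasXYX (sort-↗ R) ∘ HasXYZX⇒HasXYX)
  unreverse : HasXYZX (reverse (L ++ sort R)) → HasXYZX (L ++ sort R)
  unreverse = subst HasXYZX (reverse-involutive (L ++ sort R)) ∘ HasXYZX-reverse
  aca : HasXYX (L ++ sort R)
  aca = a , c , a≢c , Sublist.++⁺ʳ (sort R) (Sublist.++⁺ˡ C (refl ∷ refl ∷ refl ∷ minimum A))
  perm : L ++ sort R ↭ a ∷ c ∷ a ∷ N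
  perm = begin
    L ++ sort R                      ↭⟨ ++⁺ˡ L (sort-↭ R) ⟩
    L ++ R                           ≡⟨ ++-assoc C (a ∷ c ∷ a ∷ A) R ⟩
    C ++ (a ∷ c ∷ a ∷ []) ++ A ++ R  ↭⟨ shifts C (a ∷ c ∷ a ∷ []) ⟩
    a ∷ c ∷ a ∷ C ++ A ++ R          ↭⟨ prep a (prep c (prep a (shifts C A))) ⟩
    a ∷ c ∷ a ∷ A ++ C ++ R          ↭⟨ prep a (prep c (prep a (++⁺ˡ A (↭-sym B↭CR)))) ⟩
    a ∷ c ∷ a ∷ A ++ B               ↭⟨ prep a (prep c (prep a (↭-sym N↭AB))) ⟩
    a ∷ c ∷ a ∷ N                    ∎
    where open PermutationReasoning

proposition5p2 : (σ : List Sock) → Standardized σ → ¬ Sorted σ → ¬ IsAiBAj σ →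
    (M : List Sock) → Σ (List Sock) (λ q → q ↭ M × ¬ Sorted q) →
    Σ (List Sock) (λ p → p ↭ M × ((k : ℕ) → ¬ Sorted (iter k (φ σ) p)))
proposition5p2 σ _ σ-unsorted σ-aiba M (q , q↭M , q-unsorted) with ¬Sorted⇒HasXYX q-unsorted
... | a , c , a≢c , aca⊆q with ⊆-complement aca⊆q
... | N , q↭acaN =
  NeverSortableOn-resp-↭ (↭-trans (↭-sym q↭acaN) q↭M)
    ([ id , (λ σ-xyzx → HasXYZX⇒rearrangement σ-xyzx a≢c N) ]′
       (rearrangement-or-HasXYZX (¬Sorted⇒HasXYX σ-unsorted) σ-aiba a≢c N))
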